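{- Let $L_{\square_\epsilon}$ be the logic in the language $\mathcal{L}_{\square_\epsilon}$ axiomatised by all instances of classical propositional tautologies together with the following axiom schemes (for all formulas $\phi,\psi$ and all $\epsilon,\gamma,\delta\in G$): (K) $\square_\epsilon(\phi\rightarrow\psi)\rightarrow(\square_\epsilon\phi\rightarrow\square_\epsilon\psi)$; (T) $\square_\epsilon\phi\rightarrow\phi$; ($UM_1$) $\square_\epsilon\phi\rightarrow\Diamond_\epsilon\phi$; (TI) $\square_\gamma\square_\delta\phi\leftrightarrow\square_{\max\{\gamma,\delta\}}\phi$; ($UM_2$) $\Diamond_\epsilon\phi\rightarrow\square_\epsilon\Diamond_\epsilon\phi$; ($UM_3$) $\square_\gamma\phi\rightarrow\square_\delta\phi$ whenever $\gamma\geq\delta$; (D) $\Diamond_\epsilon\phi\leftrightarrow\neg\square_\epsilon\neg\phi$; ($UM_4$) $\phi\rightarrow\square_\epsilon\Diamond_\epsilon\phi$; and closed under the rules Modus Ponens (from $\phi$ and $\phi\rightarrow\psi$ infer $\psi$) and Necessitation (from $\phi$ infer $\square_\epsilon\phi$, for every $\epsilon\in G$). Then $L_{\square_\epsilon}$ is sound with respect to the class of ultra-metric spaces: every theorem of $L_{\square_\epsilon}$ is valid in every ultra-metric space.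
   Context: Fix a countable set $G\subseteq[0,1]$ with $0,1\in G$ and a set $\mathsf{Prop}$ of propositional variables. The language $\mathcal{L}_{\square_\epsilon}$ is given by $\phi ::= p \mid \phi\wedge\psi \mid \neg\phi \mid \square_\epsilon\phi$ for $p\in\mathsf{Prop}$ and $\epsilon\in G$; $\Diamond_\epsilon\phi$ abbreviates $\neg\square_\epsilon\neg\phi$, and $\rightarrow,\leftrightarrow,\vee$ are the usual Boolean abbreviations. An ultra-metric space is a pair $(X,d)$ with $d:X\times X\to\mathbb{R}$ such that for all $x,y,z$: $d(x,y)\ge 0$, $d(x,y)=d(y,x)$, $d(x,y)=0$ iff $x=y$, and $d(x,z)\le\max\{d(x,y),d(y,z)\}$. A model is $(X,d,V)$ with $(X,d)$ an ultra-metric space and $V:\mathsf{Prop}\to\mathcal{P}(X)$. Satisfaction: $x\Vdash p$ iff $x\in V(p)$; Booleans as usual; $x\Vdash\square_\epsilon\psi$ iff for every $y$ with $d(x,y)\le\epsilon$, $y\Vdash\psi$. A formula is valid in the ultra-metric space $(X,d)$ if it is satisfied at every point of $X$ under every valuation $V$. -}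

module Defs where

open import Data.Nat using (ℕ)
open import Data.Bool using (Bool; true; false; _∧_; not)
open import Data.Product using (Σ; ∃; _×_; _,_; proj₁)
open import Data.Sum using (_⊎_; inj₁; inj₂)
open import Data.Empty using (⊥)
open import Relation.Nullary using (¬_)
open import Relation.Binary.PropositionalEquality using (_≡_; _≢_)
open import Relation.Binary.Structures using (IsTotalOrder)
open import Algebra.Structures using (IsCommutativeRing)

-- The real numbers, given axiomatically as a complete ordered field
-- (any two such structures are isomorphic, so quantifying over them
-- amounts to speaking about ℝ; agda-stdlib has no ℝ).

record Reals : Set₁ where
  field
    ℝ     : Set
    _+_   : ℝ → ℝ → ℝ
    _*_   : ℝ → ℝ → ℝ
    -_    : ℝ → ℝ
    0ℝ    : ℝ
    1ℝ    : ℝ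
    _≤_   : ℝ → ℝ → Set
    isCommutativeRing : IsCommutativeRing _≡_ _+_ _*_ -_ 0ℝ 1ℝ
    0≢1   : 0ℝ ≢ 1ℝ
    inverse : ∀ x → x ≢ 0ℝ → Σ ℝ (λ y → (x * y) ≡ 1ℝ)
    isTotalOrder : IsTotalOrder _≡_ _≤_
    +-mono-≤ : ∀ x y z → x ≤ y → (x + z) ≤ (y + z)
    *-nonneg : ∀ x y → 0ℝ ≤ x → 0ℝ ≤ y → 0ℝ ≤ (x * y)
    sup : (A : ℝ → Set) → Σ ℝ A → Σ ℝ (λ b → ∀ a → A a → a ≤ b) →
          Σ ℝ (λ s → (∀ a → A a → a ≤ s) ×
                     (∀ b → (∀ a → A a → a ≤ b) → s ≤ b))

  total : ∀ x y → (x ≤ y) ⊎ (y ≤ x)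
  total = IsTotalOrder.total isTotalOrder

  max : ℝ → ℝ → ℝ
  max x y with total x y
  ... | inj₁ _ = y
  ... | inj₂ _ = x

record GSet (R : Reals) : Set₁ where
  open Reals R
  field
    G      : ℝ → Set
    enum   : ℕ → ℝ
    countable : ∀ x → G x → Σ ℕ (λ n → enum n ≡ x)
    G0     : G 0ℝ
    G1     : G 1ℝ
    G⊆[0,1] : ∀ x → G x → (0ℝ ≤ x) × (x ≤ 1ℝ)

ExcludedMiddle : Set₁
ExcludedMiddle = ∀ (A : Set) → A ⊎ ¬ A

record UltraMetricSpace (R : Reals) : Set₁ where
  open Reals R
  field
    X     : Set
    d     : X → X → ℝ
    nonneg : ∀ x y → 0ℝ ≤ d x y
    symm  : ∀ x y → d x y ≡ d y x
    zero⇔ : ∀ x y → (d x y ≡ 0ℝ → x ≡ y) × (x ≡ y → d x y ≡ 0ℝ)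
    ultra : ∀ x y z → d x z ≤ max (d x y) (d y z)

data PForm : Set where
  pvar : ℕ → PForm
  pand : PForm → PForm → PForm
  pneg : PForm → PForm

evalP : (ℕ → Bool) → PForm → Bool
evalP v (pvar n)   = v n
evalP v (pand a b) = evalP v a ∧ evalP v b
evalP v (pneg a)   = not (evalP v a)

Tautology : PForm → Set
Tautology t = ∀ (v : ℕ → Bool) → evalP v t ≡ true

module Logic (R : Reals) (GS : GSet R) (Prop : Set) where
  open Reals R
  open GSet GS

  Idx : Set
  Idx = Σ ℝ G

  maxIdx : Idx → Idx → Idx
  maxIdx (γ , gγ) (δ , gδ) with total γ δ
  ... | inj₁ _ = (δ , gδ)
  ... | inj₂ _ = (γ , gγ)

  data Formula : Set where
    var : Prop → Formula
    _∧ᶠ_ : Formula → Formula → Formula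
    ¬ᶠ_ : Formula → Formula
    □ : Idx → Formula → Formula

  ◇ : Idx → Formula → Formula
  ◇ ε φ = ¬ᶠ (□ ε (¬ᶠ φ))

  _∨ᶠ_ : Formula → Formula → Formula
  φ ∨ᶠ ψ = ¬ᶠ ((¬ᶠ φ) ∧ᶠ (¬ᶠ ψ))

  _⇒_ : Formula → Formula → Formula
  φ ⇒ ψ = ¬ᶠ (φ ∧ᶠ (¬ᶠ ψ))

  _⇔_ : Formula → Formula → Formula
  φ ⇔ ψ = (φ ⇒ ψ) ∧ᶠ (ψ ⇒ φ)

  inst : (ℕ → Formula) → PForm → Formula
  inst σ (pvar n)   = σ n
  inst σ (pand a b) = inst σ a ∧ᶠ inst σ b
  inst σ (pneg a)   = ¬ᶠ (inst σ a)

  data Thm : Formula → Set where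
    taut : ∀ (t : PForm) (σ : ℕ → Formula) → Tautology t → Thm (inst σ t)
    axK  : ∀ ε φ ψ → Thm (□ ε (φ ⇒ ψ) ⇒ (□ ε φ ⇒ □ ε ψ))
    axT  : ∀ ε φ → Thm (□ ε φ ⇒ φ)
    axUM1 : ∀ ε φ → Thm (□ ε φ ⇒ ◇ ε φ)
    axTI : ∀ γ δ φ → Thm (□ γ (□ δ φ) ⇔ □ (maxIdx γ δ) φ)
    axUM2 : ∀ ε φ → Thm (◇ ε φ ⇒ □ ε (◇ ε φ))
    axUM3 : ∀ γ δ φ → proj₁ δ ≤ proj₁ γ → Thm (□ γ φ ⇒ □ δ φ)
    axD  : ∀ ε φ → Thm (◇ ε φ ⇔ (¬ᶠ (□ ε (¬ᶠ φ))))
    axUM4 : ∀ ε φ → Thm (φ ⇒ □ ε (◇ ε φ))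
    mp   : ∀ {φ ψ} → Thm φ → Thm (φ ⇒ ψ) → Thm ψ
    nec  : ∀ ε {φ} → Thm φ → Thm (□ ε φ)

  module _ (M : UltraMetricSpace R) where
    open UltraMetricSpace M

    _,_⊩_ : (Prop → X → Set) → X → Formula → Set
    V , x ⊩ var p    = V p x
    V , x ⊩ (φ ∧ᶠ ψ) = (V , x ⊩ φ) × (V , x ⊩ ψ)
    V , x ⊩ (¬ᶠ φ)   = ¬ (V , x ⊩ φ)
    V , x ⊩ □ ε φ    = ∀ y → d x y ≤ proj₁ ε → V , y ⊩ φ

    Valid : Formula → Set₁
    Valid φ = ∀ (V : Prop → X → Set) (x : X) → V , x ⊩ φ

{-# OPTIONS --safe #-}
module Submission where

-- Symmetry of d
-- validates UM₄. The ultrametric inequality makes closed balls behave like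
-- equivalence classes (if d x y ≤ ε, the ε-balls around x and y coincide),
-- which validates UM₂ and □_{max γ δ} φ → □_γ □_δ φ. The converse half of
-- TI, T and UM₁ only use d x x = 0 ≤ ε, as G ⊆ [0,1]. Satisfaction is
-- Set-valued, so modus ponens and K need excluded middle, which also
-- assigns classical truth values to the atoms of a propositional tautology.

open import Defs
open import Algebra.Construct.NaturalChoice.Base using (MaxOperator)
import Algebra.Construct.NaturalChoice.MaxOp as MaxOp
open import Data.Nat using (ℕ)
open import Data.Product using (_×_; _,_; proj₁; proj₂)
open import Data.Sum using (inj₁; inj₂)
open import Function using (_∘_; id)
open import Relation.Binary.Bundles using (TotalOrder)
open import Relation.Binary.PropositionalEquality using (_≡_; refl; sym; subst)
open import Relation.Nullary using (¬_; Dec; does; proof)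
open import Relation.Nullary.Decidable using (fromSum; decidable-stable)
open import Relation.Nullary.Reflects using (Reflects; invert; ¬-reflects; _×-reflects_)

module _ (R : Reals) where
  open Reals R

  ≤-totalOrder : TotalOrder _ _ _
  ≤-totalOrder = record { isTotalOrder = isTotalOrder }

  max-operator : MaxOperator (TotalOrder.totalPreorder ≤-totalOrder)
  max-operator = record
    { _⊔_       = max
    ; x≤y⇒x⊔y≈y = x≤y⇒max≡y
    ; x≥y⇒x⊔y≈x = y≤x⇒max≡x
    }
    where
    open TotalOrder ≤-totalOrder using (antisym)

    x≤y⇒max≡y : ∀ {x y} → x ≤ y → max x y ≡ y
    x≤y⇒max≡y {x} {y} x≤y with total x y
    ... | inj₁ _   = refl
    ... | inj₂ y≤x = antisym x≤y y≤x

    y≤x⇒max≡x : ∀ {x y} → y ≤ x → max x y ≡ x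
    y≤x⇒max≡x {x} {y} y≤x with total x y
    ... | inj₁ x≤y = antisym y≤x x≤y
    ... | inj₂ _   = refl

module UltraMetricSpaceProperties {R : Reals} (M : UltraMetricSpace R) where
  open Reals R
  open UltraMetricSpace M
  open TotalOrder (≤-totalOrder R) using (trans)
  open MaxOp (max-operator R) using (⊔-lub)

  centre∈ball : ∀ x {ε} → 0ℝ ≤ ε → d x x ≤ ε
  centre∈ball x = subst (_≤ _) (sym (proj₂ (zero⇔ x x) refl))

  ball-sym : ∀ {x y ε} → d x y ≤ ε → d y x ≤ ε
  ball-sym {x} {y} = subst (_≤ _) (symm x y)

  ball-trans : ∀ {x y z ε} → d x y ≤ ε → d y z ≤ ε → d x z ≤ ε
  ball-trans {x} {y} {z} xy≤ε yz≤ε = trans (ultra x y z) (⊔-lub xy≤ε yz≤ε)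

module _ {R : Reals} {GS : GSet R} {Prop : Set} (M : UltraMetricSpace R)
         (V : Prop → UltraMetricSpace.X M → Set) where
  open Logic R GS Prop

  inst-reflects : ∀ {x} (σ : ℕ → Formula) (dec : ∀ n → Dec (_,_⊩_ M V x (σ n))) t →
                  Reflects (_,_⊩_ M V x (inst σ t)) (evalP (does ∘ dec) t)
  inst-reflects σ dec (pvar n)   = proof (dec n)
  inst-reflects σ dec (pand a b) = inst-reflects σ dec a ×-reflects inst-reflects σ dec b
  inst-reflects σ dec (pneg a)   = ¬-reflects (inst-reflects σ dec a)

module Soundness (em : ExcludedMiddle) {R : Reals} {GS : GSet R} {Prop : Set}
                 (M : UltraMetricSpace R) (V : Prop → UltraMetricSpace.X M → Set) where
  open Reals R
  open GSet GS
  open Logic R GS Prop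
  open UltraMetricSpace M
  open UltraMetricSpaceProperties M
  open TotalOrder (≤-totalOrder R) using (trans)

  _⊩_ : X → Formula → Set
  x ⊩ φ = _,_⊩_ M V x φ

  stable : ∀ {A : Set} → ¬ ¬ A → A
  stable {A} = decidable-stable (fromSum (em A))

  -- x ⊩ (φ ⇒ ψ) unfolds to ¬ (x ⊩ φ × ¬ x ⊩ ψ). Since _⊩_ is not
  -- injective, these rules are stated for arbitrary sets so that Agda can
  -- infer them from the unfolded goal.
  ⇒-intro : ∀ {A B : Set} → (A → B) → ¬ (A × ¬ B)
  ⇒-intro a→b (a , ¬b) = ¬b (a→b a)

  ⇒-elim : ∀ {A B : Set} → ¬ (A × ¬ B) → A → B
  ⇒-elim a⇒b a = stable λ ¬b → a⇒b (a , ¬b)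

  ⇔-intro : ∀ {A B : Set} → (A → B) → (B → A) → ¬ (A × ¬ B) × ¬ (B × ¬ A)
  ⇔-intro a→b b→a = ⇒-intro a→b , ⇒-intro b→a

  centre∈ball-Idx : ∀ x (ε : Idx) → d x x ≤ proj₁ ε
  centre∈ball-Idx x (ε , ε∈G) = centre∈ball x (proj₁ (G⊆[0,1] ε ε∈G))

  tautology-sound : ∀ t σ → Tautology t → ∀ x → x ⊩ inst σ t
  tautology-sound t σ tautological x =
    invert (subst (Reflects _) (tautological (does ∘ dec)) (inst-reflects M V σ dec t))
    where
    dec : ∀ n → Dec (x ⊩ σ n)
    dec n = fromSum (em (x ⊩ σ n))

  □□⇒□max : ∀ {x} γ δ φ → x ⊩ □ γ (□ δ φ) → x ⊩ □ (maxIdx γ δ) φ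
  □□⇒□max {x} γ@(γ′ , _) δ@(δ′ , _) φ □□φ y with total γ′ δ′
  ... | inj₁ _ = λ xy≤δ → □□φ x (centre∈ball-Idx x γ) y xy≤δ
  ... | inj₂ _ = λ xy≤γ → □□φ y xy≤γ y (centre∈ball-Idx y δ)

  □max⇒□□ : ∀ {x} γ δ φ → x ⊩ □ (maxIdx γ δ) φ → x ⊩ □ γ (□ δ φ)
  □max⇒□□ (γ , _) (δ , _) φ □φ z xz≤γ y zy≤δ with total γ δ
  ... | inj₁ γ≤δ = □φ y (ball-trans (trans xz≤γ γ≤δ) zy≤δ)
  ... | inj₂ δ≤γ = □φ y (ball-trans xz≤γ (trans zy≤δ δ≤γ))

  sound : ∀ {φ} → Thm φ → ∀ x → x ⊩ φ
  sound (taut t σ tautological) = tautology-sound t σ tautological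
  sound (axK ε φ ψ) x = ⇒-intro λ □φ⇒ψ → ⇒-intro λ □φ y xy≤ε →
    ⇒-elim (□φ⇒ψ y xy≤ε) (□φ y xy≤ε)
  sound (axT ε φ) x = ⇒-intro λ □φ → □φ x (centre∈ball-Idx x ε)
  sound (axUM1 ε φ) x = ⇒-intro λ □φ □¬φ →
    □¬φ x (centre∈ball-Idx x ε) (□φ x (centre∈ball-Idx x ε))
  sound (axTI γ δ φ) x = ⇔-intro (□□⇒□max γ δ φ) (□max⇒□□ γ δ φ)
  sound (axUM2 ε φ) x = ⇒-intro λ ◇φ y xy≤ε □¬φ →
    ◇φ λ z xz≤ε → □¬φ z (ball-trans (ball-sym xy≤ε) xz≤ε)
  sound (axUM3 γ δ φ δ≤γ) x = ⇒-intro λ □φ y xy≤δ → □φ y (trans xy≤δ δ≤γ)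
  sound (axD ε φ) x = ⇔-intro id id
  sound (axUM4 ε φ) x = ⇒-intro λ φ-holds y xy≤ε □¬φ → □¬φ x (ball-sym xy≤ε) φ-holds
  sound (mp φ-thm φ⇒ψ-thm) x = ⇒-elim (sound φ⇒ψ-thm x) (sound φ-thm x)
  sound (nec ε φ-thm) x y _ = sound φ-thm y

proposition5 : ExcludedMiddle → (R : Reals) (GS : GSet R) (Prop : Set)
    (φ : Logic.Formula R GS Prop) → Logic.Thm R GS Prop φ →
    (M : UltraMetricSpace R) → Logic.Valid R GS Prop M φ
proposition5 em R GS Prop φ φ-thm M V x = Soundness.sound em M V φ-thm x
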